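{- Let $G=G(V,E)$ be a connected simple graph with $|V|=n$, and let $(O_t)_{t\ge0}$ be the Edge-Label-Reversal stochastic process on the acyclic orientations of $G$. Then for every acyclic orientation $O$ of $G$, $$\lim_{N\to\infty}\frac1N\sum_{t=1}^N\mathbb{P}(O_t=O)=\frac{e(O)}{n!},$$ independently of the initial choice of $O_0$ (equivalently of $f_0$).
   Context: The Edge-Label-Reversal process: choose an arbitrary bijection $f_0:V\to[n]$. For $t\ge1$, choose an edge $e_t=\{u_t,v_t\}\in E$ uniformly at random (independently) and let $f_t$ be $f_{t-1}$ with the values at $u_t$ and $v_t$ swapped. $O_t$ is the acyclic orientation of $G$ induced by $f_t$: each edge $\{u,v\}$ is oriented $(u,v)$ iff $f_t(u)<f_t(v)$. An acyclic orientation $O$ is viewed as the poset on $V$ it generates ($(u,v)$ meaning $u<_O v$), and $e(O)$ is its number of linear extensions, i.e. bijections $f:V\to[n]$ with $u<_O v\Rightarrow f(u)<f(v)$. -}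

module Defs where

open import Data.Nat as ℕ using (ℕ; zero; suc; _^_; _<ᵇ_; _≤_)

open import Data.Fin as F using (Fin; toℕ)
open import Data.Fin.Base using () renaming (_<_ to _<F_)
open import Data.Bool using (Bool; true; false; _∧_; not; if_then_else_)
open import Data.List as L using (List; []; _∷_; length; concatMap; map)
open import Data.Product using (_×_; _,_; ∃; ∃-syntax; proj₁; proj₂)
open import Data.Sum using (_⊎_)
open import Data.Integer using (ℤ; +_)
open import Data.Rational as Q using (ℚ; 0ℚ)
open import Function.Definitions using (Bijective)
open import Relation.Binary.PropositionalEquality using (_≡_; _≗_)
open import Relation.Binary.Construct.Closure.Transitive using (TransClosure)
open import Relation.Binary.Construct.Closure.ReflexiveTransitive using (Star)
open import Relation.Nullary using (¬_)

Graph : ℕ → Set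
Graph n = Fin n → Fin n → Bool

IsSimple : ∀ {n} → Graph n → Set
IsSimple {n} adj = (∀ u v → adj u v ≡ adj v u) × (∀ v → adj v v ≡ false)

Adj : ∀ {n} → Graph n → Fin n → Fin n → Set
Adj adj u v = adj u v ≡ true

IsConnected : ∀ {n} → Graph n → Set
IsConnected adj = ∀ u v → Star (Adj adj) u v

vertices : (n : ℕ) → List (Fin n)
vertices n = L.tabulate (λ i → i)

-- the edge set E: each edge {u,v} listed once, as the pair (u,v) with u < v
edges : ∀ {n} → Graph n → List (Fin n × Fin n)
edges {n} adj =
  concatMap (λ u → map (u ,_) (L.filterᵇ (λ v → adj u v ∧ (toℕ u <ᵇ toℕ v)) (vertices n)))
            (vertices n)

-- Orientations.  O u v ≡ true  means the edge {u,v} is oriented (u,v).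

Orientation : ℕ → Set
Orientation n = Fin n → Fin n → Bool

Arc : ∀ {n} → Orientation n → Fin n → Fin n → Set
Arc O u v = O u v ≡ true

IsOrientationOf : ∀ {n} → Graph n → Orientation n → Set
IsOrientationOf adj O =
  ∀ u v → (adj u v ≡ true → (O u v ≡ true × O v u ≡ false) ⊎ (O u v ≡ false × O v u ≡ true))
        × (adj u v ≡ false → O u v ≡ false)

IsAcyclic : ∀ {n} → Orientation n → Set
IsAcyclic O = ∀ v → ¬ TransClosure (Arc O) v v

IsAcyclicOrientationOf : ∀ {n} → Graph n → Orientation n → Set
IsAcyclicOrientationOf adj O = IsOrientationOf adj O × IsAcyclic O

_<[_]_ : ∀ {n} → Fin n → Orientation n → Fin n → Set
u <[ O ] v = TransClosure (Arc O) u v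

-- Labelings f : V → [n]  (here [n] = Fin n).

Labeling : ℕ → Set
Labeling n = Fin n → Fin n

IsBijection : ∀ {n} → Labeling n → Set
IsBijection f = Bijective _≡_ _≡_ f

IsLinearExtension : ∀ {n} → Orientation n → Labeling n → Set
IsLinearExtension O f = IsBijection f × (∀ u v → u <[ O ] v → f u <F f v)

-- "the set {x | P x} has exactly k elements", counted up to a given
-- equivalence _≈_ (for functions we use pointwise equality _≗_).
record CountIs {A : Set} (_≈_ : A → A → Set) (P : A → Set) (k : ℕ) : Set where
  field
    elem     : Fin k → A
    sound    : ∀ i → P (elem i)
    distinct : ∀ i j → elem i ≈ elem j → i ≡ j
    complete : ∀ x → P x → ∃[ i ] (x ≈ elem i)

NumLinExt : ∀ {n} → Orientation n → ℕ → Set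
NumLinExt O k = CountIs _≗_ (IsLinearExtension O) k

_==ᶠ_ : ∀ {n} → Fin n → Fin n → Bool
u ==ᶠ v = toℕ u ℕ.≡ᵇ toℕ v

swap : ∀ {n} → Labeling n → Fin n × Fin n → Labeling n
swap f (u , v) w = if w ==ᶠ u then f v else (if w ==ᶠ v then f u else f w)

-- run f0 (e₁ ∷ e₂ ∷ … ∷ eₜ ∷ []) = f_t
run : ∀ {n} → Labeling n → List (Fin n × Fin n) → Labeling n
run f []       = f
run f (e ∷ es) = run (swap f e) es

induced : ∀ {n} → Graph n → Labeling n → Orientation n
induced adj f u v = adj u v ∧ (toℕ (f u) <ᵇ toℕ (f v))

_==ᵇ_ : Bool → Bool → Bool
x ==ᵇ y = if x then y else not y

allᵇ : ∀ {A : Set} → (A → Bool) → List A → Bool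
allᵇ p []       = true
allᵇ p (x ∷ xs) = p x ∧ allᵇ p xs

sameOrientation : ∀ {n} → Orientation n → Orientation n → Bool
sameOrientation {n} O O' =
  allᵇ (λ u → allᵇ (λ v → O u v ==ᵇ O' u v) (vertices n)) (vertices n)

sequences : ∀ {A : Set} → List A → ℕ → List (List A)
sequences xs zero    = [] ∷ []
sequences xs (suc t) = concatMap (λ x → map (x ∷_) (sequences xs t)) xs

countᵇ : ∀ {A : Set} → (A → Bool) → List A → ℕ
countᵇ p xs = length (L.filterᵇ p xs)

-- division with the (irrelevant here) convention q / 0 = 0
_/'_ : ℤ → ℕ → ℚ
p /' zero  = 0ℚ
p /' suc k = p Q./ suc k

-- P(O_t = O): the edges e₁,…,eₜ are independent and uniform on E,
-- so this is #{(e₁,…,eₜ) ∈ Eᵗ | O_t = O} / |E|ᵗ.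
probAt : ∀ {n} → Graph n → Labeling n → Orientation n → ℕ → ℚ
probAt adj f0 O t =
  (+ countᵇ (λ s → sameOrientation (induced adj (run f0 s)) O) (sequences (edges adj) t))
    /' (length (edges adj) ^ t)

sumProb : ∀ {n} → Graph n → Labeling n → Orientation n → ℕ → ℚ
sumProb adj f0 O zero    = 0ℚ
sumProb adj f0 O (suc N) = sumProb adj f0 O N Q.+ probAt adj f0 O (suc N)

cesaro : ∀ {n} → Graph n → Labeling n → Orientation n → ℕ → ℚ
cesaro adj f0 O N = sumProb adj f0 O N Q.* ((+ 1) /' N)

ConvergesTo : (ℕ → ℚ) → ℚ → Set
ConvergesTo a ℓ = ∀ (ε : ℚ) → 0ℚ Q.< ε → ∃[ N₀ ] (∀ N → N₀ ≤ N → Q.∣ a N Q.- ℓ ∣ Q.< ε)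

module Submission where

-- Counting edge sequences, P(O_t = O) = hits t f₀ / mᵗ, so the N-th mean
-- is W N f₀ / (N·m^N) where W N f = Σ_{t=1}^{N} m^(N-t)·hits t f.
--  (1) First-step decomposition makes W N near-harmonic for the walk that
--      swaps the labels at the ends of a random edge: Σ_e W N (swap f e)
--      equals m·W N f up to boundary terms at most m^(N+1).
--  (2) Swapping along a fixed edge permutes the n! bijections, so
--      Σ_π W N π = N·m^N·e(O), a bijection inducing O exactly when it is
--      a linear extension of O.
--  (3) In a connected graph any bijection is reached from any other by
--      edge swaps, along paths of bounded length.
--  (4) A discrete maximum principle then keeps every W N π within
--      C·m^(N+1) of W N f₀, with C independent of N, so
--      |n!·W N f₀ − N·m^N·e(O)| ≤ n!·C·m^(N+1).
--  (5) Dividing by n!·N·m^N, the error of the mean is at most C·m/N.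

open import Defs

open import Data.Bool using (Bool; true; false; _∧_; if_then_else_; T)
open import Data.Empty using (⊥-elim)
open import Data.Fin as F using (Fin; toℕ; _≟_; fromℕ<; punchIn; punchOut; remQuot; combine)
open import Data.Fin.Permutation using (Permutation; permutation)
open import Data.Fin.Properties
  using (toℕ-injective; toℕ-fromℕ<; toℕ<n; punchIn-injective; punchInᵢ≢i;
         punchOut-injective; punchOut-cong; punchIn-punchOut; punchOut-punchIn;
         remQuot-combine; combine-remQuot)
import Data.Fin.Properties as Fin
open import Data.Integer as ℤ using (ℤ; -[1+_]; +[1+_]; _⊖_)
import Data.Integer.Properties as ℤ
open import Data.List as L using (List; []; _∷_; length; map; _++_)
import Data.List.Extrema.Nat as Extrema
open import Data.List.Membership.Propositional using (_∈_; lose)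
open import Data.List.Membership.Propositional.Properties
  using (∈-allFin; ∈-length; ∈-map⁺; ∈-filter⁺; ∈-concatMap⁺)
open import Data.List.Properties using (map-cong)
open import Data.List.Relation.Unary.All as All using (All; []; _∷_)
open import Data.List.Relation.Unary.All.Properties using (++⁺)
open import Data.List.Relation.Unary.Any using (here; there)
open import Data.Nat as ℕ
  using (ℕ; zero; suc; _+_; _*_; _^_; _!; _≤_; _<_; z≤n; s≤s; NonZero; _<ᵇ_)
import Data.Nat.ListAction as ListAction
open import Data.Nat.Properties hiding (_≟_; suc-injective)
open import Algebra.Properties.CommutativeMonoid.Sum +-0-commutativeMonoid
  using (sum; sum-cong-≗; ∑-distrib-+; ∑-comm; ∑-permute; sum-replicate-zero)
open import Algebra.Properties.Semiring.Sum +-*-semiring using (*-distribˡ-sum)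
open import Data.Nat.Solver using (module +-*-Solver)
open import Data.Product using (_×_; _,_; ∃; proj₁; proj₂; Σ)
open import Data.Rational as ℚ using (ℚ; mkℚ; toℚᵘ)
open import Data.Rational.Properties
  using (toℚᵘ-fromℚᵘ; toℚᵘ-injective; toℚᵘ-cong; toℚᵘ-homo-+; toℚᵘ-homo-*; toℚᵘ-homo‿-;
         toℚᵘ-homo-∣-∣; toℚᵘ-cancel-<)
open import Data.Rational.Unnormalised as ℚᵘ
  using (ℚᵘ; mkℚᵘ; *≡*; *<*; ↥_; ↧_)
  renaming (_≃_ to _≃ᵘ_; _/_ to _ᵘ/_; _+_ to _ᵘ+_; _*_ to _ᵘ*_; _-_ to _ᵘ-_; ∣_∣ to ∣_∣ᵘ; _<_ to _<ᵘ_)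
import Data.Rational.Unnormalised.Properties as ℚᵘ
open import Data.Sum using (inj₁; inj₂)
open import Function using (_∘_)
open import Function.Definitions using (Injective)
open import Relation.Binary.Construct.Closure.ReflexiveTransitive using (Star; ε; _◅_)
open import Relation.Binary.Construct.Closure.Transitive using ([_]; _∷_)
open import Relation.Binary.Definitions using (tri<; tri≈; tri>)
open import Relation.Binary.PropositionalEquality
open import Relation.Nullary using (yes; no; Dec; does)
open import Relation.Nullary.Decidable using (T?)
open import Relation.Nullary.Negation using (contradiction)

open +-*-Solver

sumL : {A : Set} → List A → (A → ℕ) → ℕ
sumL xs φ = ListAction.sum (L.map φ xs)

sumL-cong : {A : Set} (xs : List A) {φ ψ : A → ℕ} → (∀ x → φ x ≡ ψ x) → sumL xs φ ≡ sumL xs ψ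
sumL-cong xs eq = cong ListAction.sum (map-cong eq xs)

sumL-+ : {A : Set} (xs : List A) (φ ψ : A → ℕ) →
  sumL xs (λ x → φ x + ψ x) ≡ sumL xs φ + sumL xs ψ
sumL-+ [] φ ψ = refl
sumL-+ (x ∷ xs) φ ψ rewrite sumL-+ xs φ ψ =
  solve 4 (λ a b c d → (a :+ b) :+ (c :+ d) := (a :+ c) :+ (b :+ d)) refl
    (φ x) (ψ x) (sumL xs φ) (sumL xs ψ)

sumL-* : {A : Set} (xs : List A) (c : ℕ) (φ : A → ℕ) → sumL xs (λ x → c * φ x) ≡ c * sumL xs φ
sumL-* [] c φ = sym (*-zeroʳ c)
sumL-* (x ∷ xs) c φ rewrite sumL-* xs c φ = sym (*-distribˡ-+ c (φ x) _)

sumL-const : {A : Set} (xs : List A) (c : ℕ) → sumL xs (λ _ → c) ≡ length xs * c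
sumL-const [] c = refl
sumL-const (x ∷ xs) c = cong (c +_) (sumL-const xs c)

sumL-≤ : {A : Set} (xs : List A) {φ : A → ℕ} (c : ℕ) → (∀ x → φ x ≤ c) → sumL xs φ ≤ length xs * c
sumL-≤ [] c le = z≤n
sumL-≤ (x ∷ xs) c le = +-mono-≤ (le x) (sumL-≤ xs c le)

sumL-≥ : {A : Set} (xs : List A) {φ : A → ℕ} (c : ℕ) → (∀ x → c ≤ φ x) → length xs * c ≤ sumL xs φ
sumL-≥ [] c le = z≤n
sumL-≥ (x ∷ xs) c le = +-mono-≤ (le x) (sumL-≥ xs c le)

sumL-single-upper : {A : Set} (xs : List A) {φ : A → ℕ} (M : ℕ) {e : A} → e ∈ xs →
  (∀ x → φ x ≤ M) → sumL xs φ + M ≤ φ e + length xs * M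
sumL-single-upper (x ∷ xs) {φ} M (here refl) le = begin
  φ x + sumL xs φ + M          ≡⟨ +-assoc (φ x) _ M ⟩
  φ x + (sumL xs φ + M)        ≤⟨ +-monoʳ-≤ (φ x) (+-monoˡ-≤ M (sumL-≤ xs M le)) ⟩
  φ x + (length xs * M + M)    ≡⟨ cong (φ x +_) (+-comm (length xs * M) M) ⟩
  φ x + length (x ∷ xs) * M    ∎
  where open ≤-Reasoning
sumL-single-upper (x ∷ xs) {φ} M {e} (there e∈xs) le = begin
  φ x + sumL xs φ + M          ≡⟨ +-assoc (φ x) _ M ⟩
  φ x + (sumL xs φ + M)        ≤⟨ +-mono-≤ (le x) (sumL-single-upper xs M e∈xs le) ⟩
  M + (φ e + length xs * M)    ≡⟨ solve 3 (λ a b c → a :+ (b :+ c) := b :+ (a :+ c)) refl M (φ e) _ ⟩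
  φ e + length (x ∷ xs) * M    ∎
  where open ≤-Reasoning

sumL-single-lower : {A : Set} (xs : List A) {φ : A → ℕ} (μ : ℕ) {e : A} → e ∈ xs →
  (∀ x → μ ≤ φ x) → φ e + length xs * μ ≤ sumL xs φ + μ
sumL-single-lower (x ∷ xs) {φ} μ (here refl) le = begin
  φ x + (μ + length xs * μ)    ≡⟨ solve 3 (λ a b c → a :+ (b :+ c) := a :+ c :+ b) refl (φ x) μ _ ⟩
  φ x + length xs * μ + μ      ≤⟨ +-monoˡ-≤ μ (+-monoʳ-≤ (φ x) (sumL-≥ xs μ le)) ⟩
  φ x + sumL xs φ + μ          ∎
  where open ≤-Reasoning
sumL-single-lower (x ∷ xs) {φ} μ {e} (there e∈xs) le = begin
  φ e + (μ + length xs * μ)    ≡⟨ solve 3 (λ a b c → a :+ (b :+ c) := b :+ (a :+ c)) refl (φ e) μ _ ⟩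
  μ + (φ e + length xs * μ)    ≤⟨ +-mono-≤ (le x) (sumL-single-lower xs μ e∈xs le) ⟩
  φ x + (sumL xs φ + μ)        ≡⟨ sym (+-assoc (φ x) _ μ) ⟩
  φ x + sumL xs φ + μ          ∎
  where open ≤-Reasoning

sum-* : ∀ {K} (c : ℕ) (f : Fin K → ℕ) → sum (λ i → c * f i) ≡ c * sum f
sum-* c f = sym (*-distribˡ-sum c f)

sum-≤ : ∀ {K} (g : Fin K → ℕ) (c : ℕ) → (∀ i → g i ≤ c) → sum g ≤ K * c
sum-≤ {zero} g c h = z≤n
sum-≤ {suc K} g c h = +-mono-≤ (h F.zero) (sum-≤ (λ i → g (F.suc i)) c (λ i → h (F.suc i)))

sum-≥ : ∀ {K} (g : Fin K → ℕ) (c : ℕ) → (∀ i → c ≤ g i) → K * c ≤ sum g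
sum-≥ {zero} g c h = z≤n
sum-≥ {suc K} g c h = +-mono-≤ (h F.zero) (sum-≥ (λ i → g (F.suc i)) c (λ i → h (F.suc i)))

sum-sumL-comm : {A : Set} {K : ℕ} (xs : List A) (g : Fin K → A → ℕ) →
  sum (λ i → sumL xs (g i)) ≡ sumL xs (λ x → sum (λ i → g i x))
sum-sumL-comm {K = K} [] g = sum-replicate-zero K
sum-sumL-comm (x ∷ xs) g =
  trans (∑-distrib-+ (λ i → g i x) (λ i → sumL xs (g i)))
        (cong (sum (λ i → g i x) +_) (sum-sumL-comm xs g))

sum-zero : ∀ {K} (q : Fin K → ℕ) → (∀ i → q i ≡ 0) → sum q ≡ 0
sum-zero {K} q h = trans (sum-cong-≗ h) (sum-replicate-zero K)

sum-single : ∀ {K} (q : Fin K → ℕ) (k : Fin K) → q k ≡ 1 → (∀ i → i ≢ k → q i ≡ 0) → sum q ≡ 1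
sum-single q F.zero h1 h0 rewrite h1 =
  cong suc (sum-zero _ (λ i → h0 (F.suc i) (λ ())))
sum-single q (F.suc k) h1 h0 rewrite h0 F.zero (λ ()) =
  sum-single (λ i → q (F.suc i)) k h1 (λ i i≢k → h0 (F.suc i) (i≢k ∘ Fin.suc-injective))

sum-indicator-image : ∀ {e K} (p : Fin K → Bool) (α : Fin e → Fin K) → Injective _≡_ _≡_ α →
  (∀ j → p (α j) ≡ true) → (∀ i → p i ≡ true → ∃ λ j → α j ≡ i) →
  sum (λ i → if p i then 1 else 0) ≡ e
sum-indicator-image {e} {K} p α α-inj p-image p-onto = begin
  sum (λ i → if p i then 1 else 0)   ≡⟨ sum-cong-≗ preimages ⟨
  sum (λ i → sum (λ j → δ (α j) i))  ≡⟨ ∑-comm (λ i j → δ (α j) i) ⟩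
  sum (λ j → sum (λ i → δ (α j) i))  ≡⟨ sum-cong-≗ (λ j → sum-single (δ (α j)) (α j) (δ-same (α j))
                                                                  (δ-other (α j))) ⟩
  sum {e} (λ _ → 1)                  ≡⟨ sum-ones e ⟩
  e                                  ∎
  where
  open ≡-Reasoning
  δ : Fin K → Fin K → ℕ
  δ k i = if does (k ≟ i) then 1 else 0
  δ-same : ∀ k → δ k k ≡ 1
  δ-same k with k ≟ k
  ... | yes _  = refl
  ... | no k≢k = contradiction refl k≢k
  δ-other : ∀ k i → i ≢ k → δ k i ≡ 0
  δ-other k i i≢k with k ≟ i
  ... | yes k≡i = contradiction (sym k≡i) i≢k
  ... | no _    = refl
  sum-ones : ∀ k → sum {k} (λ _ → 1) ≡ k
  sum-ones zero    = refl
  sum-ones (suc k) = cong suc (sum-ones k)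
  preimages : ∀ i → sum (λ j → δ (α j) i) ≡ (if p i then 1 else 0)
  preimages i with p i in pi
  ... | true = sum-single _ j₀ (subst (λ k → δ k i ≡ 1) (sym αj₀≡i) (δ-same i)) others
    where
    j₀ = proj₁ (p-onto i pi)
    αj₀≡i = proj₂ (p-onto i pi)
    others : ∀ j → j ≢ j₀ → δ (α j) i ≡ 0
    others j j≢j₀ = δ-other (α j) i (λ i≡αj → j≢j₀ (α-inj (trans (sym i≡αj) (sym αj₀≡i))))
  ... | false = sum-zero _ none
    where
    none : ∀ j → δ (α j) i ≡ 0
    none j with α j ≟ i
    ... | yes refl = contradiction (trans (sym pi) (p-image j)) (λ ())
    ... | no _     = refl

countᵇ-cong : {A : Set} (xs : List A) {p q : A → Bool} → (∀ x → p x ≡ q x) → countᵇ p xs ≡ countᵇ q xs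
countᵇ-cong [] eq = refl
countᵇ-cong (x ∷ xs) {p} {q} eq with p x | q x | eq x
... | true  | true  | refl = cong suc (countᵇ-cong xs eq)
... | false | false | refl = countᵇ-cong xs eq

countᵇ-++ : {A : Set} (p : A → Bool) (xs ys : List A) → countᵇ p (xs ++ ys) ≡ countᵇ p xs + countᵇ p ys
countᵇ-++ p [] ys = refl
countᵇ-++ p (x ∷ xs) ys with p x
... | true  = cong suc (countᵇ-++ p xs ys)
... | false = countᵇ-++ p xs ys

countᵇ-map : {A B : Set} (p : B → Bool) (g : A → B) (xs : List A) →
  countᵇ p (map g xs) ≡ countᵇ (p ∘ g) xs
countᵇ-map p g [] = refl
countᵇ-map p g (x ∷ xs) with p (g x)
... | true  = cong suc (countᵇ-map p g xs)
... | false = countᵇ-map p g xs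

countᵇ-concatMap : {A B : Set} (p : B → Bool) (g : A → List B) (xs : List A) →
  countᵇ p (L.concatMap g xs) ≡ sumL xs (λ x → countᵇ p (g x))
countᵇ-concatMap p g [] = refl
countᵇ-concatMap p g (x ∷ xs) =
  trans (countᵇ-++ p (g x) _) (cong (countᵇ p (g x) +_) (countᵇ-concatMap p g xs))

τ : ∀ {n} → Fin n → Fin n → Fin n → Fin n
τ a b w with w ≟ a
... | yes _ = b
... | no _ with w ≟ b
...   | yes _ = a
...   | no _  = w

τ-a : ∀ {n} (a b : Fin n) → τ a b a ≡ b
τ-a a b with a ≟ a
... | yes _  = refl
... | no a≢a = contradiction refl a≢a

τ-b : ∀ {n} (a b : Fin n) → τ a b b ≡ a
τ-b a b with b ≟ a
... | yes b≡a = b≡a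
... | no _ with b ≟ b
...   | yes _  = refl
...   | no b≢b = contradiction refl b≢b

τ-other : ∀ {n} {a b w : Fin n} → w ≢ a → w ≢ b → τ a b w ≡ w
τ-other {a = a} {b} {w} w≢a w≢b with w ≟ a
... | yes w≡a = contradiction w≡a w≢a
... | no _ with w ≟ b
...   | yes w≡b = contradiction w≡b w≢b
...   | no _    = refl

-- The remaining laws are proved by case analysis on the position of w,
-- done through a local `cases` so as not to abstract over τ's own tests.
τ-involutive : ∀ {n} (a b w : Fin n) → τ a b (τ a b w) ≡ w
τ-involutive a b w = cases (w ≟ a) (w ≟ b)
  where
  cases : Dec (w ≡ a) → Dec (w ≡ b) → τ a b (τ a b w) ≡ w
  cases (yes refl) _        rewrite τ-a w b = τ-b w b
  cases (no _)     (yes refl) rewrite τ-b a w = τ-a a w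
  cases (no w≢a)   (no w≢b) rewrite τ-other {a = a} {b} w≢a w≢b = τ-other w≢a w≢b

τ-sym : ∀ {n} (a b w : Fin n) → τ a b w ≡ τ b a w
τ-sym a b w = cases (w ≟ a) (w ≟ b)
  where
  cases : Dec (w ≡ a) → Dec (w ≡ b) → τ a b w ≡ τ b a w
  cases (yes refl) _        = trans (τ-a w b) (sym (τ-b b w))
  cases (no _)     (yes refl) = trans (τ-b a w) (sym (τ-a w a))
  cases (no w≢a)   (no w≢b)   = trans (τ-other w≢a w≢b) (sym (τ-other w≢b w≢a))

τ-self : ∀ {n} (a w : Fin n) → τ a a w ≡ w
τ-self a w = cases (w ≟ a)
  where
  cases : Dec (w ≡ a) → τ a a w ≡ w
  cases (yes refl) = τ-a w w
  cases (no w≢a)   = τ-other w≢a w≢a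

τ-conj : ∀ {n} {a b c : Fin n} → a ≢ b → b ≢ c → a ≢ c → ∀ w → τ a b (τ b c (τ a b w)) ≡ τ a c w
τ-conj {a = a} {b} {c} a≢b b≢c a≢c w = cases (w ≟ a) (w ≟ b) (w ≟ c)
  where
  cases : Dec (w ≡ a) → Dec (w ≡ b) → Dec (w ≡ c) → τ a b (τ b c (τ a b w)) ≡ τ a c w
  cases (yes refl) _ _
    rewrite τ-a w b | τ-a b c | τ-other {a = w} {b} (a≢c ∘ sym) (b≢c ∘ sym) = sym (τ-a w c)
  cases (no _) (yes refl) _
    rewrite τ-b a w | τ-other {a = w} {c} a≢b a≢c | τ-a a w = sym (τ-other (a≢b ∘ sym) b≢c)
  cases (no w≢a) (no w≢b) (yes refl)
    rewrite τ-other {a = a} {b} w≢a w≢b | τ-b b w | τ-b a b = sym (τ-b a w)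
  cases (no w≢a) (no w≢b) (no w≢c)
    rewrite τ-other {a = a} {b} w≢a w≢b | τ-other {a = b} {c} w≢b w≢c
          | τ-other {a = a} {b} w≢a w≢b = sym (τ-other w≢a w≢c)

==ᶠ-true : ∀ {n} {u v : Fin n} → u ≡ v → (u ==ᶠ v) ≡ true
==ᶠ-true {u = u} refl with toℕ u ℕ.≡ᵇ toℕ u | ≡⇒≡ᵇ (toℕ u) (toℕ u) refl
... | true | _ = refl

==ᶠ-false : ∀ {n} {u v : Fin n} → u ≢ v → (u ==ᶠ v) ≡ false
==ᶠ-false {u = u} {v} u≢v with toℕ u ℕ.≡ᵇ toℕ v in eq
... | false = refl
... | true  = contradiction (toℕ-injective (≡ᵇ⇒≡ (toℕ u) (toℕ v) (subst T (sym eq) _))) u≢v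

swap-τ : ∀ {n} (f : Labeling n) a b w → swap f (a , b) w ≡ f (τ a b w)
swap-τ f a b w with w ≟ a
... | yes w≡a rewrite ==ᶠ-true w≡a = refl
... | no w≢a with w ≟ b
...   | yes w≡b rewrite ==ᶠ-false w≢a | ==ᶠ-true w≡b = refl
...   | no w≢b  rewrite ==ᶠ-false w≢a | ==ᶠ-false w≢b = refl

swap-cong : ∀ {n} {f g : Labeling n} → f ≗ g → ∀ e → swap f e ≗ swap g e
swap-cong {f = f} {g} f≗g (a , b) w =
  trans (swap-τ f a b w) (trans (f≗g (τ a b w)) (sym (swap-τ g a b w)))

swap-involutive : ∀ {n} (f : Labeling n) e → swap (swap f e) e ≗ f
swap-involutive f (a , b) w =
  trans (swap-τ (swap f (a , b)) a b w)
        (trans (swap-τ f a b (τ a b w)) (cong f (τ-involutive a b w)))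

swap-bijective : ∀ {n} {f : Labeling n} → IsBijection f → ∀ e → IsBijection (swap f e)
swap-bijective {f = f} (f-inj , f-surj) (a , b) = inj , surj
  where
  inj : ∀ {x y} → swap f (a , b) x ≡ swap f (a , b) y → x ≡ y
  inj {x} {y} eq = begin
    x                 ≡⟨ τ-involutive a b x ⟨
    τ a b (τ a b x)   ≡⟨ cong (τ a b) (f-inj (trans (sym (swap-τ f a b x)) (trans eq (swap-τ f a b y)))) ⟩
    τ a b (τ a b y)   ≡⟨ τ-involutive a b y ⟩
    y                 ∎
    where open ≡-Reasoning
  surj : ∀ y → ∃ λ x → ∀ {z} → z ≡ x → swap f (a , b) z ≡ y
  surj y with f-surj y
  ... | x , fx≡y = τ a b x , λ { refl →
    trans (swap-τ f a b (τ a b x)) (trans (cong f (τ-involutive a b x)) (fx≡y refl)) }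

run-cong : ∀ {n} {f g : Labeling n} → f ≗ g → ∀ s → run f s ≗ run g s
run-cong f≗g []      = f≗g
run-cong f≗g (e ∷ s) = run-cong (swap-cong f≗g e) s

run-++ : ∀ {n} (f : Labeling n) s s' → run f (s ++ s') ≡ run (run f s) s'
run-++ f []      s' = refl
run-++ f (e ∷ s) s' = run-++ (swap f e) s s'

-- An enumeration  perm n : Fin (n !) → Labeling n  of all bijections
-- Fin n → Fin n, up to pointwise equality.  The k-th bijection sends 0 to
-- the first component i of k ∈ Fin (n · (n-1)!) and the rest to the
-- (n-1)-bijection indexed by the second component, pushed past i.

perm : (n : ℕ) → Fin (n !) → Labeling n
perm (suc n) k F.zero    = proj₁ (remQuot {suc n} (n !) k)
perm (suc n) k (F.suc z) =
  punchIn (proj₁ (remQuot {suc n} (n !) k)) (perm n (proj₂ (remQuot {suc n} (n !) k)) z)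

perm-bijective : ∀ n k → IsBijection (perm n k)
perm-bijective zero    k = (λ { {()} }) , λ ()
perm-bijective (suc n) k = inj , surj
  where
  i = proj₁ (remQuot {suc n} (n !) k)
  j = proj₂ (remQuot {suc n} (n !) k)
  rest = perm-bijective n j
  inj : ∀ {x y} → perm (suc n) k x ≡ perm (suc n) k y → x ≡ y
  inj {F.zero}  {F.zero}  _  = refl
  inj {F.zero}  {F.suc b} eq = ⊥-elim (punchInᵢ≢i i _ (sym eq))
  inj {F.suc a} {F.zero}  eq = ⊥-elim (punchInᵢ≢i i _ eq)
  inj {F.suc a} {F.suc b} eq = cong F.suc (proj₁ rest (punchIn-injective i _ _ eq))
  surj : ∀ y → ∃ λ x → ∀ {z} → z ≡ x → perm (suc n) k z ≡ y
  surj y with y ≟ i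
  ... | yes refl = F.zero , λ { refl → refl }
  ... | no y≢i   = F.suc (proj₁ (proj₂ rest y')) , λ { refl →
          trans (cong (punchIn i) (proj₂ (proj₂ rest y') refl)) (punchIn-punchOut (y≢i ∘ sym)) }
    where y' = punchOut {i = i} {j = y} (y≢i ∘ sym)

perm-injective : ∀ n k k' → perm n k ≗ perm n k' → k ≡ k'
perm-injective zero    F.zero F.zero _ = refl
perm-injective (suc n) k k' eq = begin
  k                         ≡⟨ combine-remQuot {suc n} (n !) k ⟨
  combine (proj₁ q) (proj₂ q)   ≡⟨ cong₂ combine heads tails ⟩
  combine (proj₁ q') (proj₂ q') ≡⟨ combine-remQuot {suc n} (n !) k' ⟩
  k'                        ∎
  where
  open ≡-Reasoning
  q  = remQuot {suc n} (n !) k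
  q' = remQuot {suc n} (n !) k'
  heads : proj₁ q ≡ proj₁ q'
  heads = eq F.zero
  tails : proj₂ q ≡ proj₂ q'
  tails = perm-injective n _ _ λ z → punchIn-injective (proj₁ q) _ _
    (trans (eq (F.suc z)) (cong (λ i → punchIn i (perm n (proj₂ q') z)) (sym heads)))

perm-complete : ∀ n (f : Labeling n) → IsBijection f → ∃ λ k → f ≗ perm n k
perm-complete zero    f _ = F.zero , λ ()
perm-complete (suc n) f (f-inj , f-surj) = combine i (proj₁ rec) , agree
  where
  i = f F.zero
  i≢f[suc] : ∀ z → i ≢ f (F.suc z)
  i≢f[suc] z eq with f-inj eq
  ... | ()
  g : Labeling n
  g z = punchOut (i≢f[suc] z)
  g-inj : ∀ {a b} → g a ≡ g b → a ≡ b
  g-inj {a} {b} eq with f-inj (punchOut-injective (i≢f[suc] a) (i≢f[suc] b) eq)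
  ... | refl = refl
  g-surj : ∀ y → ∃ λ x → ∀ {z} → z ≡ x → g z ≡ y
  g-surj y with f-surj (punchIn i y) | proj₂ (f-surj (punchIn i y)) refl
  ... | F.zero  , _ | eq = ⊥-elim (punchInᵢ≢i i y (sym eq))
  ... | F.suc x , _ | eq = x , λ { refl → trans (punchOut-cong i eq) (punchOut-punchIn i) }
  rec = perm-complete n g (g-inj , g-surj)
  split = remQuot-combine {suc n} {n !} i (proj₁ rec)
  agree : f ≗ perm (suc n) (combine i (proj₁ rec))
  agree F.zero    = sym (cong proj₁ split)
  agree (F.suc z) =
    trans (sym (punchIn-punchOut (i≢f[suc] z)))
          (trans (cong (punchIn i) (proj₂ rec z))
                 (sym (cong (λ p → punchIn (proj₁ p) (perm n (proj₂ p) z)) split)))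

module Process {n : ℕ} (adj : Graph n) (O : Orientation n) where

  E : List (Fin n × Fin n)
  E = edges adj

  m : ℕ
  m = length E

  inducesO : Labeling n → Bool
  inducesO f = sameOrientation (induced adj f) O

  inducesO-cong : ∀ {f g : Labeling n} → f ≗ g → inducesO f ≡ inducesO g
  inducesO-cong f≗g = allᵇ-cong (vertices n) λ u → allᵇ-cong (vertices n) λ v →
    cong (λ b → b ==ᵇ O u v)
         (cong (adj u v ∧_) (cong₂ (λ a b → toℕ a <ᵇ toℕ b) (f≗g u) (f≗g v)))
    where
    allᵇ-cong : {A : Set} {p q : A → Bool} (xs : List A) → (∀ x → p x ≡ q x) → allᵇ p xs ≡ allᵇ q xs
    allᵇ-cong []       eq = refl
    allᵇ-cong (x ∷ xs) eq = cong₂ _∧_ (eq x) (allᵇ-cong xs eq)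

  atO : Labeling n → ℕ
  atO f = if inducesO f then 1 else 0

  -- hits t f = #{ s ∈ Eᵗ | the run from f along s ends inducing O },
  -- so that P(O_t = O) = hits t f₀ / mᵗ.
  hits : ℕ → Labeling n → ℕ
  hits t f = countᵇ (λ s → inducesO (run f s)) (sequences E t)

  hits-cong : ∀ t {f g : Labeling n} → f ≗ g → hits t f ≡ hits t g
  hits-cong t f≗g = countᵇ-cong (sequences E t) (λ s → inducesO-cong (run-cong f≗g s))

  hits-zero : ∀ f → hits 0 f ≡ atO f
  hits-zero f with inducesO f
  ... | true  = refl
  ... | false = refl

  hits-suc : ∀ t f → hits (suc t) f ≡ sumL E (λ e → hits t (swap f e))
  hits-suc t f =
    trans (countᵇ-concatMap _ (λ e → map (e ∷_) (sequences E t)) E)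
          (sumL-cong E (λ e → countᵇ-map (λ s → inducesO (run f s)) (e ∷_) (sequences E t)))

  hits-≤ : ∀ t f → hits t f ≤ m ^ t
  hits-≤ zero f rewrite hits-zero f with inducesO f
  ... | true  = ≤-refl
  ... | false = z≤n
  hits-≤ (suc t) f rewrite hits-suc t f = sumL-≤ E (m ^ t) (λ e → hits-≤ t (swap f e))

  -- Cumulative weighted count  W N f = Σ_{t=1}^{N} m^(N-t) · hits t f,
  -- so that Σ_{t=1}^{N} P(O_t = O) = W N f₀ / m^N.
  W : ℕ → Labeling n → ℕ
  W zero    f = 0
  W (suc N) f = m * W N f + hits (suc N) f

  W-cong : ∀ N {f g : Labeling n} → f ≗ g → W N f ≡ W N g
  W-cong zero    f≗g = refl
  W-cong (suc N) f≗g = cong₂ (λ a b → m * a + b) (W-cong N f≗g) (hits-cong (suc N) f≗g)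

  -- W N is "near-harmonic" for the edge-swap walk: averaging over the
  -- neighbours reproduces it up to the boundary terms m^N·hits 1 and hits (N+1).
  W-harmonic : ∀ N f → sumL E (λ e → W N (swap f e)) + m ^ N * hits 1 f ≡ m * W N f + hits (suc N) f
  W-harmonic zero f = begin
    sumL E (λ _ → 0) + 1 * hits 1 f   ≡⟨ cong₂ _+_ (trans (sumL-const E 0) (*-zeroʳ m)) (*-identityˡ _) ⟩
    hits 1 f                          ≡⟨ cong (_+ hits 1 f) (*-zeroʳ m) ⟨
    m * 0 + hits 1 f                  ∎
    where open ≡-Reasoning
  W-harmonic (suc N) f = begin
    sumL E (λ e → m * W N (swap f e) + hits (suc N) (swap f e)) + m ^ suc N * hits 1 f
      ≡⟨ cong (_+ m ^ suc N * hits 1 f) (trans (sumL-+ E _ _) (cong₂ _+_ (sumL-* E m _) (sym (hits-suc (suc N) f)))) ⟩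
    m * neighbours + hits (suc (suc N)) f + m * m ^ N * hits 1 f
      ≡⟨ solve 5 (λ mm a t b c → mm :* a :+ t :+ mm :* b :* c := mm :* (a :+ b :* c) :+ t) refl
           m neighbours (hits (suc (suc N)) f) (m ^ N) (hits 1 f) ⟩
    m * (neighbours + m ^ N * hits 1 f) + hits (suc (suc N)) f
      ≡⟨ cong (λ z → m * z + hits (suc (suc N)) f) (W-harmonic N f) ⟩
    m * (m * W N f + hits (suc N) f) + hits (suc (suc N)) f
      ∎
    where
    open ≡-Reasoning
    neighbours = sumL E (λ e → W N (swap f e))

  -- Swapping along a fixed e permutes
  -- the bijections, so the total of hits (t+1) is m times that of hits t:
  -- the uniform distribution is stationary for the walk.

  Σperm : (Labeling n → ℕ) → ℕ
  Σperm φ = sum (λ k → φ (perm n k))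

  Σperm-swap : (e : Fin n × Fin n) (φ : Labeling n → ℕ) → (∀ {f g} → f ≗ g → φ f ≡ φ g) →
    Σperm (λ f → φ (swap f e)) ≡ Σperm φ
  Σperm-swap e φ φ-cong = begin
    sum (λ k → φ (swap (perm n k) e))   ≡⟨ sum-cong-≗ (λ k → φ-cong (index-spec k)) ⟩
    sum (λ k → φ (perm n (index k)))    ≡⟨ ∑-permute (λ k → φ (perm n k)) swapPerm ⟨
    sum (λ k → φ (perm n k))            ∎
    where
    open ≡-Reasoning
    located : ∀ k → ∃ λ k' → swap (perm n k) e ≗ perm n k'
    located k = perm-complete n (swap (perm n k) e) (swap-bijective (perm-bijective n k) e)
    index : Fin (n !) → Fin (n !)
    index k = proj₁ (located k)
    index-spec : ∀ k → swap (perm n k) e ≗ perm n (index k)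
    index-spec k = proj₂ (located k)
    index-involutive : ∀ k → index (index k) ≡ k
    index-involutive k = perm-injective n _ _ λ w → sym (begin
      perm n k w                              ≡⟨ swap-involutive (perm n k) e w ⟨
      swap (swap (perm n k) e) e w            ≡⟨ swap-cong (index-spec k) e w ⟩
      swap (perm n (index k)) e w             ≡⟨ index-spec (index k) w ⟩
      perm n (index (index k)) w              ∎)
    swapPerm : Permutation (n !) (n !)
    swapPerm = permutation index index index-involutive index-involutive

  Σperm-hits : ∀ t → Σperm (hits t) ≡ m ^ t * Σperm atO
  Σperm-hits zero    = trans (sum-cong-≗ (λ k → hits-zero (perm n k))) (sym (+-identityʳ _))
  Σperm-hits (suc t) = begin
    Σperm (hits (suc t))
      ≡⟨ sum-cong-≗ (λ k → hits-suc t (perm n k)) ⟩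
    sum (λ k → sumL E (λ e → hits t (swap (perm n k) e)))
      ≡⟨ sum-sumL-comm E (λ k e → hits t (swap (perm n k) e)) ⟩
    sumL E (λ e → Σperm (λ f → hits t (swap f e)))
      ≡⟨ sumL-cong E (λ e → Σperm-swap e (hits t) (hits-cong t)) ⟩
    sumL E (λ _ → Σperm (hits t))
      ≡⟨ sumL-const E _ ⟩
    m * Σperm (hits t)
      ≡⟨ cong (m *_) (Σperm-hits t) ⟩
    m * (m ^ t * Σperm atO)
      ≡⟨ *-assoc m (m ^ t) _ ⟨
    m ^ suc t * Σperm atO
      ∎
    where open ≡-Reasoning

  Σperm-W : ∀ N → Σperm (W N) ≡ N * m ^ N * Σperm atO
  Σperm-W zero    = sum-replicate-zero (n !)
  Σperm-W (suc N) = begin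
    sum (λ k → m * W N (perm n k) + hits (suc N) (perm n k))
      ≡⟨ ∑-distrib-+ (λ k → m * W N (perm n k)) (λ k → hits (suc N) (perm n k)) ⟩
    sum (λ k → m * W N (perm n k)) + Σperm (hits (suc N))
      ≡⟨ cong₂ _+_ (trans (sum-* m (λ k → W N (perm n k))) (cong (m *_) (Σperm-W N))) (Σperm-hits (suc N)) ⟩
    m * (N * m ^ N * a) + m * m ^ N * a
      ≡⟨ solve 4 (λ mm NN p a → mm :* (NN :* p :* a) :+ mm :* p :* a := (con 1 :+ NN) :* (mm :* p) :* a)
           refl m N (m ^ N) a ⟩
    suc N * m ^ suc N * a
      ∎
    where
    open ≡-Reasoning
    a = Σperm atO

  -- A bijection induces O exactly when it is a linear extension of O;
  -- hence Σperm atO counts the linear extensions: it equals e(O).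

  inducesO⇒agree : ∀ f → inducesO f ≡ true → ∀ u v → induced adj f u v ≡ O u v
  inducesO⇒agree f h u v = ==ᵇ-sound (allᵇ-sound (allᵇ-sound h (∈-allFin u)) (∈-allFin v))
    where
    allᵇ-sound : {A : Set} {p : A → Bool} {xs : List A} {x : A} → allᵇ p xs ≡ true → x ∈ xs → p x ≡ true
    allᵇ-sound {p = p} {y ∷ _} h (here refl) with p y | h
    ... | true | _ = refl
    allᵇ-sound {p = p} {y ∷ _} h (there x∈) with p y | h
    ... | true | h' = allᵇ-sound h' x∈
    ==ᵇ-sound : {a b : Bool} → (a ==ᵇ b) ≡ true → a ≡ b
    ==ᵇ-sound {true}  {true}  _ = refl
    ==ᵇ-sound {false} {false} _ = refl

  agree⇒inducesO : ∀ f → (∀ u v → induced adj f u v ≡ O u v) → inducesO f ≡ true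
  agree⇒inducesO f h = allᵇ-complete (vertices n) λ u → allᵇ-complete (vertices n) λ v →
    subst (λ b → (b ==ᵇ O u v) ≡ true) (sym (h u v)) (==ᵇ-refl (O u v))
    where
    allᵇ-complete : {A : Set} {p : A → Bool} (xs : List A) → (∀ x → p x ≡ true) → allᵇ p xs ≡ true
    allᵇ-complete []       h = refl
    allᵇ-complete (x ∷ xs) h rewrite h x = allᵇ-complete xs h
    ==ᵇ-refl : ∀ a → (a ==ᵇ a) ≡ true
    ==ᵇ-refl true  = refl
    ==ᵇ-refl false = refl

  inducesO⇒linExt : ∀ f → IsBijection f → inducesO f ≡ true → IsLinearExtension O f
  inducesO⇒linExt f bf h = bf , increasing
    where
    arc : ∀ {u v} → Arc O u v → toℕ (f u) < toℕ (f v)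
    arc {u} {v} a = <ᵇ⇒< _ _ (subst T (sym (∧-right (trans (inducesO⇒agree f h u v) a))) _)
      where
      ∧-right : {x y : Bool} → (x ∧ y) ≡ true → y ≡ true
      ∧-right {true} eq = eq
    increasing : ∀ u v → u <[ O ] v → toℕ (f u) < toℕ (f v)
    increasing u v [ a ]      = arc a
    increasing u v (a ∷ rest) = <-trans (arc a) (increasing _ v rest)

  -- Conversely (using that O orients exactly the edges of G).
  linExt⇒inducesO : IsOrientationOf adj O → ∀ f → IsLinearExtension O f → inducesO f ≡ true
  linExt⇒inducesO ori f (_ , increasing) = agree⇒inducesO f agree
    where
    agree : ∀ u v → induced adj f u v ≡ O u v
    agree u v with adj u v in edge
    ... | false = sym (proj₂ (ori u v) edge)
    ... | true with proj₁ (ori u v) edge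
    ...   | inj₁ (uv , _)  = trans (<ᵇ-true (increasing u v [ uv ])) (sym uv)
      where
      <ᵇ-true : ∀ {a b} → a < b → (a <ᵇ b) ≡ true
      <ᵇ-true {a} {b} a<b with a <ᵇ b | <⇒<ᵇ a<b
      ... | true | _ = refl
    ...   | inj₂ (uv , vu) = trans (<ᵇ-false (increasing v u [ vu ])) (sym uv)
      where
      <ᵇ-false : ∀ {a b} → b < a → (a <ᵇ b) ≡ false
      <ᵇ-false {a} {b} b<a with a <ᵇ b in eq
      ... | false = refl
      ... | true  = contradiction (<ᵇ⇒< a b (subst T (sym eq) _)) (<-asym b<a)

  Σperm-atO : IsOrientationOf adj O → (e : ℕ) → NumLinExt O e → Σperm atO ≡ e
  Σperm-atO ori e cnt =
    sum-indicator-image (λ k → inducesO (perm n k)) index index-injective hit onto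
    where
    open CountIs cnt
    located : ∀ j → ∃ λ k → elem j ≗ perm n k
    located j = perm-complete n (elem j) (proj₁ (sound j))
    index : Fin e → Fin (n !)
    index j = proj₁ (located j)
    index-injective : Injective _≡_ _≡_ index
    index-injective {j} {j'} eq =
      distinct j j' λ w → trans (proj₂ (located j) w)
                                (trans (cong (λ k → perm n k w) eq) (sym (proj₂ (located j') w)))
    hit : ∀ j → inducesO (perm n (index j)) ≡ true
    hit j = trans (sym (inducesO-cong (proj₂ (located j)))) (linExt⇒inducesO ori (elem j) (sound j))
    onto : ∀ k → inducesO (perm n k) ≡ true → ∃ λ j → index j ≡ k
    onto k h with complete (perm n k) (inducesO⇒linExt (perm n k) (perm-bijective n k) h)
    ... | j , eq = j , perm-injective n _ _ λ w → trans (sym (proj₂ (located j) w)) (sym (eq w))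

module Reachability {n : ℕ} (adj : Graph n) (simple : IsSimple adj) where

  E : List (Fin n × Fin n)
  E = edges adj

  Reach : Labeling n → Labeling n → Set
  Reach x y = Σ (List (Fin n × Fin n)) λ s → All (_∈ E) s × run x s ≗ y

  reach-refl : ∀ {x y} → x ≗ y → Reach x y
  reach-refl x≗y = [] , [] , x≗y

  reach-trans : ∀ {x y z} → Reach x y → Reach y z → Reach x z
  reach-trans {x} (s , s∈E , xs≗y) (s' , s'∈E , ys'≗z) = s ++ s' , ++⁺ s∈E s'∈E , λ w →
    trans (cong (λ g → g w) (run-++ x s s')) (trans (run-cong xs≗y s' w) (ys'≗z w))

  reach-congʳ : ∀ {x y z} → Reach x y → y ≗ z → Reach x z
  reach-congʳ (s , s∈E , xs≗y) y≗z = s , s∈E , λ w → trans (xs≗y w) (y≗z w)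

  loopless : ∀ {u v} → adj u v ≡ true → u ≢ v
  loopless {u} a refl with trans (sym a) (proj₂ simple u)
  ... | ()

  ∈-edges : ∀ {u v} → adj u v ≡ true → toℕ u < toℕ v → (u , v) ∈ E
  ∈-edges {u} {v} a u<v =
    ∈-concatMap⁺ _ (lose (∈-allFin u) (∈-map⁺ (u ,_) (∈-filter⁺ (T? ∘ test) (∈-allFin v) holds)))
    where
    test : Fin n → Bool
    test w = adj u w ∧ (toℕ u <ᵇ toℕ w)
    holds : T (test v)
    holds rewrite a = <⇒<ᵇ u<v

  edges-nonempty : 2 ≤ n → IsConnected adj → 1 ≤ length E
  edges-nonempty (s≤s (s≤s _)) conn with conn F.zero (F.suc F.zero)
  ... | _◅_ {j = w} a _ with <-cmp 0 (toℕ w)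
  ...   | tri< 0<w _ _ = ∈-length (∈-edges a 0<w)
  ...   | tri≈ _ 0≡w _ = contradiction (toℕ-injective 0≡w) (loopless a)

  swap-edge : ∀ {u v} → adj u v ≡ true → ∀ x → Reach x (swap x (u , v))
  swap-edge {u} {v} a x with <-cmp (toℕ u) (toℕ v)
  ... | tri< u<v _ _ = (u , v) ∷ [] , ∈-edges a u<v ∷ [] , λ w → refl
  ... | tri≈ _ u≡v _ = contradiction (toℕ-injective u≡v) (loopless a)
  ... | tri> _ _ v<u = (v , u) ∷ [] , ∈-edges (trans (proj₁ simple v u) a) v<u ∷ [] , λ w →
          trans (swap-τ x v u w) (trans (cong x (τ-sym v u w)) (sym (swap-τ x u v w)))

  -- Swapping the ends of a path is a product of edge swaps, by the
  -- conjugation (u w)(w v)(u w) = (u v) for the first edge {u,w}.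
  swap-path : ∀ {u v} → Star (Adj adj) u v → ∀ x → Reach x (swap x (u , v))
  swap-path {u} ε x = reach-refl λ w → sym (trans (swap-τ x u u w) (cong x (τ-self u w)))
  swap-path {u} {v} (_◅_ {j = w} a rest) x with v ≟ u | w ≟ v
  ... | yes refl | _        = reach-refl λ z → sym (trans (swap-τ x v v z) (cong x (τ-self v z)))
  ... | no _     | yes refl = swap-edge a x
  ... | no v≢u   | no w≢v   =
    reach-congʳ (reach-trans (swap-edge a x) (reach-trans (swap-path rest x₁) (swap-edge a x₂))) conj
    where
    x₁ = swap x (u , w)
    x₂ = swap x₁ (w , v)
    conj : swap x₂ (u , w) ≗ swap x (u , v)
    conj z = begin
      swap x₂ (u , w) z              ≡⟨ swap-τ x₂ u w z ⟩
      x₂ (τ u w z)                   ≡⟨ swap-τ x₁ w v (τ u w z) ⟩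
      x₁ (τ w v (τ u w z))           ≡⟨ swap-τ x u w (τ w v (τ u w z)) ⟩
      x (τ u w (τ w v (τ u w z)))    ≡⟨ cong x (τ-conj (loopless a) w≢v (v≢u ∘ sym) z) ⟩
      x (τ u v z)                    ≡⟨ swap-τ x u v z ⟨
      swap x (u , v) z               ∎
      where open ≡-Reasoning

  -- Any bijection reaches any other: as in selection sort, fix the labels
  -- at 0, 1, …, n-1 one at a time by swapping along a path.
  reach-all : IsConnected adj → ∀ {x y} → IsBijection x → IsBijection y → Reach x y
  reach-all conn {x} {y} bx by with sorted n ≤-refl
    where
    SortedBelow : ℕ → Set
    SortedBelow k = Σ (Labeling n) λ x' → Reach x x' × IsBijection x' × (∀ z → toℕ z < k → x' z ≡ y z)
    sorted : ∀ k → k ≤ n → SortedBelow k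
    sorted zero    _   = x , reach-refl (λ _ → refl) , bx , λ z ()
    sorted (suc k) k<n with sorted k (<⇒≤ k<n)
    ... | x' , x→x' , bx' , below = swap x' (v , w) , reach-trans x→x' (swap-path (conn v w) x') ,
                                      swap-bijective bx' (v , w) , below'
      where
      v = fromℕ< k<n
      w = proj₁ (proj₂ bx' (y v))
      x'w≡yv : x' w ≡ y v
      x'w≡yv = proj₂ (proj₂ bx' (y v)) refl
      below' : ∀ z → toℕ z < suc k → swap x' (v , w) z ≡ y z
      below' z z≤k with m≤n⇒m<n∨m≡n (≤-pred z≤k)
      ... | inj₂ z≡k = trans (swap-τ x' v w z) (subst (λ q → x' (τ v w q) ≡ y q) (sym z≡v)
                              (trans (cong x' (τ-a v w)) x'w≡yv))
        where
        z≡v : z ≡ v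
        z≡v = toℕ-injective (trans z≡k (sym (toℕ-fromℕ< k<n)))
      ... | inj₁ z<k = trans (swap-τ x' v w z) (trans (cong x' (τ-other z≢v z≢w)) (below z z<k))
        where
        z≢v : z ≢ v
        z≢v refl = <-irrefl (toℕ-fromℕ< k<n) z<k
        z≢w : z ≢ w
        z≢w refl = z≢v (proj₁ by (trans (sym (below z z<k)) x'w≡yv))
  ... | x' , x→x' , _ , agree = reach-congʳ x→x' (λ z → agree z (toℕ<n z))

-- Starting from a maximiser (minimiser) of h over the
-- bijections, each swap can lose (gain) at most  m·D + B  where D is the
-- loss (gain) so far; after j swaps the loss is at most growth m j · B.


-- growth m j = 1 + m + … + m^(j-1): the defect accumulated after j steps
-- of the recursion D ↦ m·D + 1 started at 0.
growth : ℕ → ℕ → ℕ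
growth m zero    = 0
growth m (suc j) = m * growth m j + 1

-- Needed to bound the defects of paths of different lengths uniformly.
growth-mono : ∀ {m} → 1 ≤ m → ∀ {j l} → j ≤ l → growth m j ≤ growth m l
growth-mono {m} 1≤m {j} {zero}  z≤n = ≤-refl
growth-mono {m} 1≤m {j} {suc l} j≤l with m≤n⇒m<n∨m≡n j≤l
... | inj₂ refl = ≤-refl
... | inj₁ j<l  = ≤-trans (growth-mono 1≤m (≤-pred j<l)) (begin
  growth m l          ≤⟨ m≤n*m (growth m l) m {{ℕ.>-nonZero 1≤m}} ⟩
  m * growth m l      ≤⟨ m≤m+n _ 1 ⟩
  growth m (suc l)    ∎)
  where open ≤-Reasoning

module MaximumPrinciple {n : ℕ} (E : List (Fin n × Fin n)) (B : ℕ) (h a b : Labeling n → ℕ)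
  (a≤B : ∀ x → a x ≤ B) (b≤B : ∀ x → b x ≤ B)
  (harmonic : ∀ x → sumL E (λ e → h (swap x e)) + a x ≡ length E * h x + b x) where

  m : ℕ
  m = length E

  along : (P : Labeling n → ℕ → Set) →
    (∀ {x j e} → IsBijection x → e ∈ E → P x j → P (swap x e) (suc j)) →
    ∀ s {x j} → IsBijection x → All (_∈ E) s → P x j → P (run x s) (length s + j)
  along P step []      bx []          p = p
  along P step (e ∷ s) {x} {j} bx (e∈E ∷ s∈E) p =
    subst (P (run (swap x e) s)) (+-suc (length s) j)
      (along P step s (swap-bijective bx e) s∈E (step bx e∈E p))

  module Descent (M : ℕ) (h≤M : ∀ y → IsBijection y → h y ≤ M) where

    descend : ∀ {x e} D → IsBijection x → e ∈ E → M ≤ h x + D → M ≤ h (swap x e) + (m * D + B)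
    descend {x} {e} D bx e∈E M≤hx+D = +-cancelʳ-≤ (m * M) M _ (begin
      M + m * M                               ≤⟨ +-monoʳ-≤ M (*-monoʳ-≤ m M≤hx+D) ⟩
      M + m * (h x + D)                       ≡⟨ cong (M +_) (*-distribˡ-+ m (h x) D) ⟩
      M + (m * h x + m * D)                   ≤⟨ +-monoʳ-≤ M (+-monoˡ-≤ (m * D) (m≤m+n (m * h x) (b x))) ⟩
      M + (m * h x + b x + m * D)             ≡⟨ cong (λ z → M + (z + m * D)) (harmonic x) ⟨
      M + (neighbours + a x + m * D)          ≤⟨ +-monoʳ-≤ M (+-monoˡ-≤ (m * D) (+-monoʳ-≤ neighbours (a≤B x))) ⟩
      M + (neighbours + B + m * D)            ≡⟨ solve 4 (λ M S B mD → M :+ (S :+ B :+ mD) := (S :+ M) :+ (mD :+ B))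
                                                           refl M neighbours B (m * D) ⟩
      (neighbours + M) + (m * D + B)          ≤⟨ +-monoˡ-≤ (m * D + B) single ⟩
      (h (swap x e) + m * M) + (m * D + B)    ≡⟨ solve 3 (λ a b c → (a :+ b) :+ c := (a :+ c) :+ b)
                                                           refl (h (swap x e)) (m * M) (m * D + B) ⟩
      h (swap x e) + (m * D + B) + m * M      ∎)
      where
      open ≤-Reasoning
      neighbours = sumL E (λ e' → h (swap x e'))
      single : neighbours + M ≤ h (swap x e) + m * M
      single = sumL-single-upper E M e∈E (λ e' → h≤M _ (swap-bijective bx e'))

    descend-path : ∀ s {x} → IsBijection x → All (_∈ E) s → M ≤ h x →
      M ≤ h (run x s) + growth m (length s) * B
    descend-path s {x} bx s∈E M≤hx =
      subst (λ j → M ≤ h (run x s) + growth m j * B) (+-identityʳ (length s))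
        (along (λ y j → M ≤ h y + growth m j * B) (λ {y} {j} → step {y} {j}) s {j = 0} bx s∈E
               (≤-trans M≤hx (m≤m+n (h x) 0)))
      where
      step : ∀ {y j e} → IsBijection y → e ∈ E →
        M ≤ h y + growth m j * B → M ≤ h (swap y e) + growth m (suc j) * B
      step {y} {j} {e} by e∈E M≤ = subst (λ z → M ≤ h (swap y e) + z)
        (solve 3 (λ m g B → m :* (g :* B) :+ B := (m :* g :+ con 1) :* B) refl m (growth m j) B)
        (descend (growth m j * B) by e∈E M≤)

  module Ascent (μ : ℕ) (μ≤h : ∀ y → IsBijection y → μ ≤ h y) where

    ascend : ∀ {x e} D → IsBijection x → e ∈ E → h x ≤ μ + D → h (swap x e) ≤ μ + (m * D + B)
    ascend {x} {e} D bx e∈E hx≤μ+D = +-cancelʳ-≤ (m * μ) _ _ (begin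
      h (swap x e) + m * μ                    ≤⟨ single ⟩
      neighbours + μ                          ≤⟨ +-monoˡ-≤ μ (m≤m+n neighbours (a x)) ⟩
      neighbours + a x + μ                    ≡⟨ cong (_+ μ) (harmonic x) ⟩
      m * h x + b x + μ                       ≤⟨ +-monoˡ-≤ μ (+-mono-≤ (*-monoʳ-≤ m hx≤μ+D) (b≤B x)) ⟩
      m * (μ + D) + B + μ                     ≡⟨ solve 4 (λ m μ D B → m :* (μ :+ D) :+ B :+ μ := μ :+ (m :* D :+ B) :+ m :* μ)
                                                           refl m μ D B ⟩
      μ + (m * D + B) + m * μ                 ∎)
      where
      open ≤-Reasoning
      neighbours = sumL E (λ e' → h (swap x e'))
      single : h (swap x e) + m * μ ≤ neighbours + μ
      single = sumL-single-lower E μ e∈E (λ e' → μ≤h _ (swap-bijective bx e'))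

    ascend-path : ∀ s {x} → IsBijection x → All (_∈ E) s → h x ≤ μ →
      h (run x s) ≤ μ + growth m (length s) * B
    ascend-path s {x} bx s∈E hx≤μ =
      subst (λ j → h (run x s) ≤ μ + growth m j * B) (+-identityʳ (length s))
        (along (λ y j → h y ≤ μ + growth m j * B) (λ {y} {j} → step {y} {j}) s {j = 0} bx s∈E
               (≤-trans hx≤μ (m≤m+n μ 0)))
      where
      step : ∀ {y j e} → IsBijection y → e ∈ E →
        h y ≤ μ + growth m j * B → h (swap y e) ≤ μ + growth m (suc j) * B
      step {y} {j} {e} by e∈E ≤μ = subst (λ z → h (swap y e) ≤ μ + z)
        (solve 3 (λ m g B → m :* (g :* B) :+ B := (m :* g :+ con 1) :* B) refl m (growth m j) B)
        (ascend (growth m j * B) by e∈E ≤μ)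

-- Fractions of naturals are handled in the
-- unnormalised rationals ℚᵘ, where  z / d  is literally  mkℚᵘ z (d - 1)
-- and sums, products and differences are computed on numerators.

/'-toℚᵘ : ∀ z d .{{_ : NonZero d}} → toℚᵘ (z /' d) ≃ᵘ z ᵘ/ d
/'-toℚᵘ z (suc d) = toℚᵘ-fromℚᵘ (mkℚᵘ z d)

ᵘ/-+ : ∀ a b c d .{{_ : NonZero b}} .{{_ : NonZero d}} →
  (ℤ.+ a) ᵘ/ b ᵘ+ (ℤ.+ c) ᵘ/ d ≃ᵘ _ᵘ/_ (ℤ.+ (a * d + c * b)) (b * d) {{m*n≢0 b d}}
ᵘ/-+ a (suc b) c (suc d) = ℚᵘ.≃-reflexive (cong (λ z → _ᵘ/_ z (suc b * suc d))
  (sym (trans (ℤ.pos-+ (a * suc d) (c * suc b)) (cong₂ ℤ._+_ (ℤ.pos-* a (suc d)) (ℤ.pos-* c (suc b))))))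

ᵘ/-* : ∀ a b c d .{{_ : NonZero b}} .{{_ : NonZero d}} →
  ((ℤ.+ a) ᵘ/ b) ᵘ* ((ℤ.+ c) ᵘ/ d) ≃ᵘ _ᵘ/_ (ℤ.+ (a * c)) (b * d) {{m*n≢0 b d}}
ᵘ/-* a (suc b) c (suc d) = ℚᵘ.≃-reflexive (cong (λ z → _ᵘ/_ z (suc b * suc d)) (sym (ℤ.pos-* a c)))

ᵘ/-- : ∀ a b c d .{{_ : NonZero b}} .{{_ : NonZero d}} →
  (ℤ.+ a) ᵘ/ b ᵘ- (ℤ.+ c) ᵘ/ d ≃ᵘ _ᵘ/_ ((a * d) ⊖ (c * b)) (b * d) {{m*n≢0 b d}}
ᵘ/-- a (suc b) c (suc d) = ℚᵘ.≃-reflexive (cong (λ z → _ᵘ/_ z (suc b * suc d)) (begin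
  ℤ.+ a ℤ.* ℤ.+ suc d ℤ.+ ℤ.- (ℤ.+ c) ℤ.* ℤ.+ suc b
    ≡⟨ cong₂ ℤ._+_ (sym (ℤ.pos-* a (suc d)))
                   (trans (sym (ℤ.neg-distribˡ-* (ℤ.+ c) (ℤ.+ suc b))) (cong ℤ.-_ (sym (ℤ.pos-* c (suc b))))) ⟩
  ℤ.+ (a * suc d) ℤ.- ℤ.+ (c * suc b)
    ≡⟨ ℤ.m-n≡m⊖n (a * suc d) (c * suc b) ⟩
  (a * suc d) ⊖ (c * suc b)
    ∎))
  where open ≡-Reasoning

ᵘ/-cong : ∀ a b c d .{{_ : NonZero b}} .{{_ : NonZero d}} → a * d ≡ c * b → (ℤ.+ a) ᵘ/ b ≃ᵘ (ℤ.+ c) ᵘ/ d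
ᵘ/-cong a (suc b) c (suc d) eq = *≡* (trans (sym (ℤ.pos-* a (suc d))) (trans (cong ℤ.+_ eq) (ℤ.pos-* c (suc b))))

∣ᵘ/∣-< : ∀ (z : ℤ) d .{{_ : NonZero d}} (q : ℚᵘ) →
  (ℤ.+ ℤ.∣ z ∣) ℤ.* ↧ q ℤ.< ↥ q ℤ.* (ℤ.+ d) → ∣ z ᵘ/ d ∣ᵘ <ᵘ q
∣ᵘ/∣-< z (suc d) q lt = *<* lt

⊖-within : ∀ a b c → a ≤ b + c → b ≤ a + c → ℤ.∣ a ⊖ b ∣ ≤ c
⊖-within a b c a≤b+c b≤a+c with ≤-total b a
... | inj₁ b≤a rewrite ℤ.⊖-≥ b≤a  = m≤n+o⇒m∸n≤o a b a≤b+c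
... | inj₂ a≤b rewrite ℤ.∣⊖∣-≤ a≤b = m≤n+o⇒m∸n≤o b a b≤a+c

ratio-limit : (a : ℕ → ℚ) (u v : ℕ → ℕ) (e K c : ℕ) .{{_ : NonZero K}} → (∀ N → NonZero (v N)) →
  (∀ N → a (suc N) ≡ (ℤ.+ u (suc N)) /' (v (suc N) * suc N)) →
  (∀ N → N * v N * e ≤ K * u N + c * v N) →
  (∀ N → K * u N ≤ N * v N * e + c * v N) →
  ConvergesTo a ((ℤ.+ e) /' K)
ratio-limit a u v e K c v≢0 a-form below above (mkℚ (ℤ.+ zero) _ _) (ℚ.*<* (ℤ.+<+ ()))
ratio-limit a u v e K c v≢0 a-form below above (mkℚ -[1+ _ ] _ _) (ℚ.*<* ())
ratio-limit a u v e K c v≢0 a-form below above ε′@(mkℚ +[1+ p ] q-1 _) _ = suc (c * q) , close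
  where
  q = suc q-1
  close : ∀ N → suc (c * q) ≤ N → ℚ.∣ a N ℚ.- (ℤ.+ e) /' K ∣ ℚ.< ε′
  close (suc N') cq<N = toℚᵘ-cancel-< (ℚᵘ.<-respˡ-≃ (ℚᵘ.≃-sym error-form) (∣ᵘ/∣-< Z D (toℚᵘ ε′) bound))
    where
    N = suc N'
    instance
      v≢0ᴺ : NonZero (v N)
      v≢0ᴺ = v≢0 N
      vN≢0 : NonZero (v N * N)
      vN≢0 = m*n≢0 (v N) N
      D≢0 : NonZero (v N * N * K)
      D≢0 = m*n≢0 (v N * N) K
    D = v N * N * K
    Z = u N * K ⊖ e * (v N * N)
    error-form : toℚᵘ ℚ.∣ a N ℚ.- (ℤ.+ e) /' K ∣ ≃ᵘ ∣ Z ᵘ/ D ∣ᵘ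
    error-form = ℚᵘ.≃-trans (toℚᵘ-homo-∣-∣ (a N ℚ.- (ℤ.+ e) /' K)) (ℚᵘ.∣-∣-cong (
      ℚᵘ.≃-trans (toℚᵘ-homo-+ (a N) (ℚ.- ((ℤ.+ e) /' K)))
     (ℚᵘ.≃-trans (ℚᵘ.+-cong (ℚᵘ.≃-trans (toℚᵘ-cong (a-form N')) (/'-toℚᵘ (ℤ.+ u N) (v N * N)))
                            (ℚᵘ.≃-trans (toℚᵘ-homo‿- ((ℤ.+ e) /' K)) (ℚᵘ.-‿cong (/'-toℚᵘ (ℤ.+ e) K))))
                 (ᵘ/-- (u N) (v N * N) e K))))
    -- |K·u N − N·v N·e| ≤ c·v N, written with the factors in the order of Z
    Z≤ : ℤ.∣ Z ∣ ≤ c * v N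
    Z≤ = ⊖-within _ _ _
      (subst₂ (λ x y → x ≤ y + c * v N) (*-comm K (u N)) reorder (above N))
      (subst₂ (λ x y → x ≤ y + c * v N) reorder (*-comm K (u N)) (below N))
      where
      reorder : N * v N * e ≡ e * (v N * N)
      reorder = solve 3 (λ N v e → N :* v :* e := e :* (v :* N)) refl N (v N) e
    Z<εD : ℤ.∣ Z ∣ * q < suc p * D
    Z<εD = begin-strict
      ℤ.∣ Z ∣ * q          ≤⟨ *-monoˡ-≤ q Z≤ ⟩
      c * v N * q          ≡⟨ solve 3 (λ c v q → c :* v :* q := c :* q :* v) refl c (v N) q ⟩
      c * q * v N          <⟨ *-monoˡ-< (v N) cq<N ⟩
      N * v N              ≡⟨ *-comm N (v N) ⟩
      v N * N              ≤⟨ m≤m*n (v N * N) K ⟩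
      D                    ≤⟨ m≤n*m D (suc p) ⟩
      suc p * D            ∎
      where open ≤-Reasoning
    bound : (ℤ.+ ℤ.∣ Z ∣) ℤ.* ↧ toℚᵘ ε′ ℤ.< ↥ toℚᵘ ε′ ℤ.* (ℤ.+ D)
    bound = subst₂ ℤ._<_ (ℤ.pos-* ℤ.∣ Z ∣ q) (ℤ.pos-* (suc p) D) (ℤ.+<+ Z<εD)

module Convergence {n : ℕ} (adj : Graph n) (O : Orientation n) (simple : IsSimple adj)
  (conn : IsConnected adj) (2≤n : 2 ≤ n) (f₀ : Labeling n) (bf₀ : IsBijection f₀) where

  open Process adj O
  open Reachability adj simple using (Reach; reach-all; edges-nonempty)

  K : ℕ
  K = n !

  1≤m : 1 ≤ m
  1≤m = edges-nonempty 2≤n conn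

  instance
    m≢0 : NonZero m
    m≢0 = ℕ.>-nonZero 1≤m
    K≢0 : NonZero K
    K≢0 = n !≢0

  sumProb-form : ∀ N → toℚᵘ (sumProb adj f₀ O N) ≃ᵘ _ᵘ/_ (ℤ.+ W N f₀) (m ^ N) {{m^n≢0 m N}}
  sumProb-form zero    = ℚᵘ.≃-refl
  sumProb-form (suc N) =
    ℚᵘ.≃-trans (toℚᵘ-homo-+ (sumProb adj f₀ O N) (probAt adj f₀ O (suc N)))
   (ℚᵘ.≃-trans (ℚᵘ.+-cong (sumProb-form N) (/'-toℚᵘ (ℤ.+ hits (suc N) f₀) (m ^ suc N)))
   (ℚᵘ.≃-trans (ᵘ/-+ (W N f₀) (m ^ N) (hits (suc N) f₀) (m ^ suc N))
               (ᵘ/-cong _ _ _ _ {{m*n≢0 (m ^ N) (m ^ suc N)}}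
                 (solve 4 (λ w t m p → (w :* (m :* p) :+ t :* p) :* (m :* p) := (m :* w :+ t) :* (p :* (m :* p)))
                    refl (W N f₀) (hits (suc N) f₀) m (m ^ N)))))
    where
    instance
      _ = m^n≢0 m N
      _ = m^n≢0 m (suc N)

  cesaro-form : ∀ N → cesaro adj f₀ O (suc N) ≡ (ℤ.+ W (suc N) f₀) /' (m ^ suc N * suc N)
  cesaro-form N' = toℚᵘ-injective (ℚᵘ.≃-trans
    (toℚᵘ-homo-* (sumProb adj f₀ O N) ((ℤ.+ 1) /' N))
    (ℚᵘ.≃-trans (ℚᵘ.*-cong (sumProb-form N) (/'-toℚᵘ (ℤ.+ 1) N))
    (ℚᵘ.≃-trans (ᵘ/-* (W N f₀) (m ^ N) 1 N)
    (ℚᵘ.≃-trans (ᵘ/-cong _ _ _ _ {{m*n≢0 (m ^ N) N}} {{m*n≢0 (m ^ N) N}}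
                  (cong (_* (m ^ N * N)) (*-identityʳ (W N f₀))))
                (ℚᵘ.≃-sym (/'-toℚᵘ (ℤ.+ W N f₀) (m ^ N * N) {{m*n≢0 (m ^ N) N}}))))))
    where
    N = suc N'
    instance
      _ = m^n≢0 m N

  -- A fixed index and, for every bijection, an edge path to f₀; C bounds
  -- the defect accumulated along any of these paths.
  k₀ : Fin K
  k₀ = proj₁ (perm-complete n f₀ bf₀)

  path : ∀ k → Reach (perm n k) f₀
  path k = reach-all conn (perm-bijective n k) bf₀

  pathLength : Fin K → ℕ
  pathLength k = length (proj₁ (path k))

  C : ℕ
  C = growth m (Extrema.max 0 (map pathLength (L.allFin K)))

  growth≤C : ∀ k → growth m (pathLength k) ≤ C
  growth≤C k = growth-mono 1≤m (All.lookup (Extrema.xs≤max 0 (map pathLength (L.allFin K)))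
                                           (∈-map⁺ pathLength (∈-allFin k)))

  -- For fixed N, W N f₀ is within C·m^(N+1) of both the largest and the
  -- smallest value of W N on bijections, hence of their average.
  module AtTime (N : ℕ) where

    B : ℕ
    B = m ^ suc N

    boundary≤B : ∀ x → m ^ N * hits 1 x ≤ B
    boundary≤B x = begin
      m ^ N * hits 1 x     ≤⟨ *-monoʳ-≤ (m ^ N) (hits-≤ 1 x) ⟩
      m ^ N * (m * 1)      ≡⟨ solve 2 (λ p m → p :* (m :* con 1) := m :* p) refl (m ^ N) m ⟩
      B                    ∎
      where open ≤-Reasoning

    open MaximumPrinciple E B (W N) (λ x → m ^ N * hits 1 x) (hits (suc N))
      boundary≤B (hits-≤ (suc N)) (W-harmonic N) using (module Descent; module Ascent)

    g : Fin K → ℕ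
    g k = W N (perm n k)

    kmax kmin : Fin K
    kmax = Extrema.argmax g k₀ (L.allFin K)
    kmin = Extrema.argmin g k₀ (L.allFin K)

    W≤max : ∀ y → IsBijection y → W N y ≤ g kmax
    W≤max y by with perm-complete n y by
    ... | k , y≗k = subst (_≤ g kmax) (sym (W-cong N y≗k))
                      (All.lookup (Extrema.f[xs]≤f[argmax] k₀ (L.allFin K)) (∈-allFin k))

    min≤W : ∀ y → IsBijection y → g kmin ≤ W N y
    min≤W y by with perm-complete n y by
    ... | k , y≗k = subst (g kmin ≤_) (sym (W-cong N y≗k))
                      (All.lookup (Extrema.f[argmin]≤f[xs] k₀ (L.allFin K)) (∈-allFin k))

    max≤W₀ : g kmax ≤ W N f₀ + C * B
    max≤W₀ = ≤-trans
      (Descent.descend-path (g kmax) W≤max s (perm-bijective n kmax) s∈E ≤-refl)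
      (+-mono-≤ (≤-reflexive (W-cong N run≗f₀)) (*-monoˡ-≤ B (growth≤C kmax)))
      where
      s = proj₁ (path kmax)
      s∈E = proj₁ (proj₂ (path kmax))
      run≗f₀ = proj₂ (proj₂ (path kmax))

    W₀≤min : W N f₀ ≤ g kmin + C * B
    W₀≤min = ≤-trans
      (≤-reflexive (sym (W-cong N run≗f₀)))
      (≤-trans (Ascent.ascend-path (g kmin) min≤W s (perm-bijective n kmin) s∈E ≤-refl)
               (+-monoʳ-≤ (g kmin) (*-monoˡ-≤ B (growth≤C kmin))))
      where
      s = proj₁ (path kmin)
      s∈E = proj₁ (proj₂ (path kmin))
      run≗f₀ = proj₂ (proj₂ (path kmin))

    average-below : N * m ^ N * Σperm atO ≤ K * W N f₀ + K * C * m * m ^ N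
    average-below = begin
      N * m ^ N * Σperm atO    ≡⟨ Σperm-W N ⟨
      Σperm (W N)              ≤⟨ sum-≤ g (g kmax) (λ k → W≤max _ (perm-bijective n k)) ⟩
      K * g kmax               ≤⟨ *-monoʳ-≤ K max≤W₀ ⟩
      K * (W N f₀ + C * B)     ≡⟨ solve 5 (λ K w C m p → K :* (w :+ C :* (m :* p)) := K :* w :+ K :* C :* m :* p)
                                    refl K (W N f₀) C m (m ^ N) ⟩
      K * W N f₀ + K * C * m * m ^ N ∎
      where open ≤-Reasoning

    average-above : K * W N f₀ ≤ N * m ^ N * Σperm atO + K * C * m * m ^ N
    average-above = begin
      K * W N f₀                       ≤⟨ *-monoʳ-≤ K W₀≤min ⟩
      K * (g kmin + C * B)             ≡⟨ solve 5 (λ K w C m p → K :* (w :+ C :* (m :* p)) := K :* w :+ K :* C :* m :* p)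
                                            refl K (g kmin) C m (m ^ N) ⟩
      K * g kmin + K * C * m * m ^ N   ≤⟨ +-monoˡ-≤ _ (sum-≥ g (g kmin) (λ k → min≤W _ (perm-bijective n k))) ⟩
      Σperm (W N) + K * C * m * m ^ N  ≡⟨ cong (_+ K * C * m * m ^ N) (Σperm-W N) ⟩
      N * m ^ N * Σperm atO + K * C * m * m ^ N ∎
      where open ≤-Reasoning

  converges : ConvergesTo (cesaro adj f₀ O) ((ℤ.+ Σperm atO) /' K)
  converges = ratio-limit (cesaro adj f₀ O) (λ N → W N f₀) (m ^_) (Σperm atO) K (K * C * m)
    (λ N → m^n≢0 m N) cesaro-form AtTime.average-below AtTime.average-above

-- Theorem 5.6: the Cesàro averages of P(O_t = O) converge to e(O) / n!.

open import Data.Integer using (+_)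

theorem5p6 : (n : ℕ) → 2 ≤ n → (adj : Graph n) → IsSimple adj → IsConnected adj →
    (f₀ : Labeling n) → IsBijection f₀ →
    (O : Orientation n) → IsAcyclicOrientationOf adj O →
    (e : ℕ) → NumLinExt O e →
    ConvergesTo (cesaro adj f₀ O) ((+ e) /' (n !))
theorem5p6 n 2≤n adj simple conn f₀ bf₀ O (orientation , _) e linExt =
  subst (λ k → ConvergesTo (cesaro adj f₀ O) ((+ k) /' (n !)))
        (Process.Σperm-atO adj O orientation e linExt)
        (Convergence.converges adj O simple conn 2≤n f₀ bf₀)
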